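{- Let $(S,\cdot)$ be a semigroup and $A\subseteq S$. Then $A$ is an FP-set if and only if there is a pruned FP-tree in $A$. Moreover, if $\alpha\in A^*$ is idempotent, then there is an FP-tree $T$ in $A$ such that $\alpha\in B_f^*$ for all $f\in T$.
   Context: For a sequence $\langle s_n\rangle$ (finite or infinite) in $S$, $\mathrm{FP}(\langle s_n\rangle)$ is the set of all products $s_{j_1}s_{j_2}\cdots s_{j_k}$ with $j_1<\dots<j_k$, $k\ge1$. $A$ is an FP-set if there is a sequence $\langle s_n\rangle_{n=1}^\infty$ in $S$ with $\mathrm{FP}(\langle s_n\rangle_{n=1}^\infty)\subseteq A$. Trees: natural numbers $n$ are identified with $\{0,\dots,n-1\}$. A tree in a set $X$ is a nonempty set $T$ of functions $f:n\to X$ ($n\in\omega$) closed under restriction to initial segments. For $f\in T$ with domain $n$ and $x\in X$, $f^\frown x=f\cup\{(n,x)\}$; $B_f=\{x\in X:f^\frown x\in T\}$; $T$ is pruned if $B_f\ne\emptyset$ for all $f\in T$. For $f\subsetneq g$ in $T$ (with $X=S$), $P_{g-f}=\mathrm{FP}(\langle g(i)\rangle_{\mathrm{dom}(f)\le i<\mathrm{dom}(g)})$. A tree $T$ in $S$ is an FP-tree if $B_f=\bigcup_{g\in T,\,f\subsetneq g}P_{g-f}$ for every $f\in T$. "A tree in $A$" means a tree in the set $A$. Nonstandard setup: sufficiently saturated framework with iterated star map; $S^*$, $S^{**}$; for $\alpha\in S^*$, $\alpha^*\in S^{**}$, and $\alpha\cdot\alpha^*\in S^{**}$ by transfer. For $\gamma\in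 S^{(k)*}$, $\mathcal U_\gamma=\{B\subseteq S:\gamma\in B^{(k)*}\}$; $\gamma\sim\delta$ iff $\mathcal U_\gamma=\mathcal U_\delta$. $\alpha\in S^*$ is idempotent if $\alpha\cdot\alpha^*\sim\alpha$. -}

module Defs where

open import Level using (0ℓ)
open import Data.Nat using (ℕ; _≤_)
open import Data.List using (List; []; _∷_; _++_; take; length; map; upTo)
open import Data.List.Relation.Unary.All using (All)
open import Data.List.Relation.Binary.Sublist.Propositional using (_⊆_)
open import Data.Product using (Σ; ∃; _×_; _,_)
open import Data.Sum using (_⊎_)
open import Data.Empty using (⊥)
open import Relation.Nullary using (¬_)
open import Relation.Binary.PropositionalEquality using (_≡_)
open import Relation.Unary using (Pred)
open import Function.Bundles using (_⇔_)

module _ {S : Set} (_∙_ : S → S → S) where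

  prod : S → List S → S
  prod x []       = x
  prod x (y ∷ ys) = x ∙ prod y ys

  -- FP of a finite sequence: products s_{j1}⋯s_{jk}, j1<…<jk, k ≥ 1,
  -- i.e. products of nonempty sublists (order preserved).
  FPList : List S → Pred S 0ℓ
  FPList xs y = Σ S λ z → Σ (List S) λ zs → ((z ∷ zs) ⊆ xs) × (y ≡ prod z zs)

  -- FP of an infinite sequence s : ℕ → S: products over finitely many
  -- strictly increasing indices; every such index set lies in some {0,…,n-1}.
  FPSeq : (ℕ → S) → Pred S 0ℓ
  FPSeq s y = Σ ℕ λ n → FPList (map s (upTo n)) y

  IsFPSet : Pred S 0ℓ → Set
  IsFPSet A = Σ (ℕ → S) λ s → ∀ y → FPSeq s y → A y

  -- Trees: finite sequences f : n → X are lists of length n.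
  -- f ⁀ x = f ++ [ x ];  restriction to initial segment n = take n f.
  record IsTree (T : Pred (List S) 0ℓ) : Set where
    field
      nonempty   : Σ (List S) T
      downClosed : ∀ f → T f → ∀ n → n ≤ length f → T (take n f)

  B : Pred (List S) 0ℓ → List S → Pred S 0ℓ
  B T f x = T (f ++ (x ∷ []))

  IsPruned : Pred (List S) 0ℓ → Set
  IsPruned T = ∀ f → T f → Σ S (B T f)

  -- f ⊊ g  in T  means  g = f ++ h  with h nonempty; then P_{g-f} = FP(h).
  IsFPTree : Pred (List S) 0ℓ → Set
  IsFPTree T = IsTree T ×
    (∀ f → T f → ∀ x →
       B T f x ⇔ (Σ S λ h₀ → Σ (List S) λ hs →
                    T (f ++ (h₀ ∷ hs)) × FPList (h₀ ∷ hs) x))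

  TreeIn : Pred S 0ℓ → Pred (List S) 0ℓ → Set
  TreeIn A T = ∀ f → T f → All A f

  -- Ultrafilters on S (subsets as predicates).  U_α for α ∈ S* is
  -- exactly such an ultrafilter, with  B ∈ U_α  iff  α ∈ B*.
  record Ultrafilter : Set₁ where
    field
      _∈U   : Pred S 0ℓ → Set
      upward : ∀ {P Q : Pred S 0ℓ} → (∀ x → P x → Q x) → P ∈U → Q ∈U
      inter  : ∀ {P Q : Pred S 0ℓ} → P ∈U → Q ∈U → (λ x → P x × Q x) ∈U
      proper : ¬ ((λ _ → ⊥) ∈U)
      ultra  : ∀ (P : Pred S 0ℓ) → P ∈U ⊎ (λ x → ¬ P x) ∈U
  open Ultrafilter public

  -- α idempotent (α·α* ∼ α) translates to U_α = U_α ⊗ U_α: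
  -- P ∈ U  iff  { x : { y : x∙y ∈ P } ∈ U } ∈ U.
  IsIdempotent : Ultrafilter → Set₁
  IsIdempotent U = ∀ (P : Pred S 0ℓ) →
    _∈U U P ⇔ _∈U U (λ x → _∈U U (λ y → P (x ∙ y)))

{-# OPTIONS --safe #-}
-- Both trees are trees of walks: a state σ says which x may be appended next
-- (Next σ x) and which state follows.  Such a tree is an FP-tree once every
-- y ∈ FP(h) for a walk h from σ is again admissible at σ; by induction on h this
-- needs only that moves never enlarge Next and that x ∙ z is admissible at σ
-- whenever z is admissible after the move x.  For A ⊇ FP(s) the states are the
-- tails of s and x is admissible if it lies in FP of a finite initial block, which
-- gives a pruned FP-tree in A.  For an idempotent U ∋ A the states are sets C ∈ U,
-- x is admissible if x ∈ C⋆ = {x ∈ C : x⁻¹C ∈ U}, and the next state is C ∩ x⁻¹C,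
-- again in U; idempotence is exactly C⋆ ∈ U, so every B_f is in U.  Conversely,
-- a branch s of a pruned FP-tree T in A has FP(s) ⊆ B_∅ ⊆ A.
module Submission where

open import Defs
open import Level using (0ℓ)
open import Data.Nat using (ℕ; zero; suc; _+_; z≤n)
open import Data.List using (List; []; _∷_; _++_; take; map; upTo; applyUpTo)
open import Data.List.Properties using (applyUpTo-∷ʳ; map-upTo)
open import Data.List.Relation.Unary.All as All using (All; []; _∷_)
open import Data.List.Relation.Binary.Sublist.Propositional using ([]; _∷_; _∷ʳ_)
open import Data.List.Relation.Binary.Sublist.Propositional.Properties using (++⁺; ++⁺ˡ)
open import Data.Product using (Σ; ∃; _×_; _,_; proj₁; proj₂)
open import Data.Sum using (_⊎_; inj₁; inj₂)
open import Data.Unit using (⊤; tt)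
open import Data.Empty using (⊥-elim)
open import Function using (_∘_)
open import Function.Bundles using (_⇔_; mk⇔; Equivalence)
open import Relation.Binary.PropositionalEquality
  using (_≡_; refl; sym; trans; cong; cong₂; subst; module ≡-Reasoning)
open import Relation.Nullary using (¬_)
open import Relation.Unary using (Pred; _∩_)
open import Algebra.Definitions using (Associative)
open import Algebra.Structures using (IsSemigroup)

applyUpTo-+ : ∀ {a} {X : Set a} (t : ℕ → X) k n →
              applyUpTo t (k + n) ≡ applyUpTo t k ++ applyUpTo (t ∘ (k +_)) n
applyUpTo-+ t zero    n = refl
applyUpTo-+ t (suc k) n = cong (t 0 ∷_) (applyUpTo-+ (t ∘ suc) k n)

map-upTo-+ : ∀ {a} {X : Set a} (t : ℕ → X) k n →
             map t (upTo (k + n)) ≡ map t (upTo k) ++ map (t ∘ (k +_)) (upTo n)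
map-upTo-+ t k n = begin
  map t (upTo (k + n))                         ≡⟨ map-upTo t (k + n) ⟩
  applyUpTo t (k + n)                          ≡⟨ applyUpTo-+ t k n ⟩
  applyUpTo t k ++ applyUpTo (t ∘ (k +_)) n    ≡⟨ sym (cong₂ _++_ (map-upTo t k) (map-upTo (t ∘ (k +_)) n)) ⟩
  map t (upTo k) ++ map (t ∘ (k +_)) (upTo n)  ∎
  where open ≡-Reasoning

module _ {S : Set} (_∙_ : S → S → S) where

  FPList-[] : ∀ {y} → ¬ FPList _∙_ [] y
  FPList-[] (_ , _ , () , _)

  FPList-singleton : ∀ x → FPList _∙_ (x ∷ []) x
  FPList-singleton x = x , [] , refl ∷ [] , refl

  FPList-++⁺ˡ : ∀ xs {ys y} → FPList _∙_ ys y → FPList _∙_ (xs ++ ys) y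
  FPList-++⁺ˡ xs (z , zs , z∷zs⊆ys , y≡) = z , zs , ++⁺ˡ xs z∷zs⊆ys , y≡

  FPList-∷⁻ : ∀ {x xs y} → FPList _∙_ (x ∷ xs) y →
              y ≡ x ⊎ FPList _∙_ xs y ⊎ ∃ λ z → FPList _∙_ xs z × y ≡ x ∙ z
  FPList-∷⁻ (z , zs , _ ∷ʳ z∷zs⊆xs , y≡) = inj₂ (inj₁ (z , zs , z∷zs⊆xs , y≡))
  FPList-∷⁻ (_ , [] , refl ∷ _ , y≡) = inj₁ y≡
  FPList-∷⁻ (_ , w ∷ ws , refl ∷ w∷ws⊆xs , y≡) =
    inj₂ (inj₂ (prod _∙_ w ws , (w , ws , w∷ws⊆xs , refl) , y≡))

  FPSeq-drop : ∀ t k {y} → FPSeq _∙_ (t ∘ (k +_)) y → FPSeq _∙_ t y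
  FPSeq-drop t k (n , y∈) =
    k + n , subst (λ l → FPList _∙_ l _) (sym (map-upTo-+ t k n))
            (FPList-++⁺ˡ (map t (upTo k)) y∈)

  module _ (assoc : Associative _≡_ _∙_) where

    prod-++ : ∀ z zs w ws → prod _∙_ z (zs ++ w ∷ ws) ≡ prod _∙_ z zs ∙ prod _∙_ w ws
    prod-++ z []       w ws = refl
    prod-++ z (u ∷ us) w ws = begin
      z ∙ prod _∙_ u (us ++ w ∷ ws)          ≡⟨ cong (z ∙_) (prod-++ u us w ws) ⟩
      z ∙ (prod _∙_ u us ∙ prod _∙_ w ws)    ≡⟨ sym (assoc z (prod _∙_ u us) (prod _∙_ w ws)) ⟩
      (z ∙ prod _∙_ u us) ∙ prod _∙_ w ws    ∎
      where open ≡-Reasoning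

    FPList-∙ : ∀ {xs ys y z} → FPList _∙_ xs y → FPList _∙_ ys z →
               FPList _∙_ (xs ++ ys) (y ∙ z)
    FPList-∙ (y₀ , ys , p , refl) (z₀ , zs , q , refl) =
      y₀ , ys ++ z₀ ∷ zs , ++⁺ p q , sym (prod-++ y₀ ys z₀ zs)

    FPSeq-∙ : ∀ t k {x z} → FPList _∙_ (map t (upTo k)) x → FPSeq _∙_ (t ∘ (k +_)) z →
              FPSeq _∙_ t (x ∙ z)
    FPSeq-∙ t k x∈ (n , z∈) =
      k + n , subst (λ l → FPList _∙_ l _) (sym (map-upTo-+ t k n))
              (FPList-∙ x∈ z∈)

  module PathTree {ℓ} {State : Set ℓ} (Next : State → Pred S 0ℓ)
                  (next : ∀ σ x → Next σ x → State) where

    Path : State → Pred (List S) 0ℓ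
    Path σ []      = ⊤
    Path σ (x ∷ f) = Σ (Next σ x) λ w → Path (next σ x w) f

    after : ∀ σ f → Path σ f → State
    after σ []      _       = σ
    after σ (x ∷ f) (w , p) = after (next σ x w) f p

    Path-++⁺ : ∀ σ f {g} (p : Path σ f) → Path (after σ f p) g → Path σ (f ++ g)
    Path-++⁺ σ []      _       q = q
    Path-++⁺ σ (x ∷ f) (w , p) q = w , Path-++⁺ (next σ x w) f p q

    Path-++⁻ : ∀ σ f {g} → Path σ (f ++ g) → Σ (Path σ f) λ p → Path (after σ f p) g
    Path-++⁻ σ []      q       = tt , q
    Path-++⁻ σ (x ∷ f) (w , q) with Path-++⁻ (next σ x w) f q
    ... | p , r = (w , p) , r

    Path-∷ʳ : ∀ σ f (p : Path σ f) {x} → Next (after σ f p) x → B _∙_ (Path σ) f x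
    Path-∷ʳ σ f p w = Path-++⁺ σ f p (w , tt)

    Path-take : ∀ σ n f → Path σ f → Path σ (take n f)
    Path-take σ zero    f       _       = tt
    Path-take σ (suc n) []      _       = tt
    Path-take σ (suc n) (x ∷ f) (w , p) = w , Path-take (next σ x w) n f p

    Path-isTree : ∀ σ → IsTree _∙_ (Path σ)
    Path-isTree σ = record
      { nonempty   = [] , tt
      ; downClosed = λ f p n _ → Path-take σ n f p
      }

    Path-pruned : (∀ σ → ∃ (Next σ)) → ∀ σ → IsPruned _∙_ (Path σ)
    Path-pruned total σ f p = let (x , w) = total (after σ f p) in x , Path-∷ʳ σ f p w

    after-preserves : (Inv : State → Set) → (∀ σ x w → Inv σ → Inv (next σ x w)) →
                      ∀ σ f (p : Path σ f) → Inv σ → Inv (after σ f p)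
    after-preserves Inv pres σ []      _       inv = inv
    after-preserves Inv pres σ (x ∷ f) (w , p) inv =
      after-preserves Inv pres (next σ x w) f p (pres σ x w inv)

    module FPClosed
      (shrink : ∀ {σ x} (w : Next σ x) {y} → Next (next σ x w) y → Next σ y)
      (absorb : ∀ {σ x} (w : Next σ x) {z} → Next (next σ x w) z → Next σ (x ∙ z))
      where

      FPList⊆Next : ∀ σ h → Path σ h → ∀ {y} → FPList _∙_ h y → Next σ y
      FPList⊆Next σ []      _       y∈ = ⊥-elim (FPList-[] y∈)
      FPList⊆Next σ (x ∷ h) (w , p) y∈ with FPList-∷⁻ y∈
      ... | inj₁ refl                 = w
      ... | inj₂ (inj₁ y∈h)           = shrink w (FPList⊆Next (next σ x w) h p y∈h)
      ... | inj₂ (inj₂ (z , z∈h , refl)) = absorb w (FPList⊆Next (next σ x w) h p z∈h)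

      Path-isFPTree : ∀ σ → IsFPTree _∙_ (Path σ)
      Path-isFPTree σ = Path-isTree σ , λ f _ x → mk⇔
        (λ fx∈T → x , [] , fx∈T , FPList-singleton x)
        (λ (h₀ , hs , fh∈T , x∈h) →
           let (p , q) = Path-++⁻ σ f fh∈T
           in Path-∷ʳ σ f p (FPList⊆Next (after σ f p) (h₀ ∷ hs) q x∈h))

      Path-treeIn : ∀ {A : Pred S 0ℓ} σ → (∀ x → Next σ x → A x) → TreeIn _∙_ A (Path σ)
      Path-treeIn σ Next⊆A []      _       = []
      Path-treeIn σ Next⊆A (x ∷ f) (w , p) =
        Next⊆A x w ∷ Path-treeIn (next σ x w) (λ y v → Next⊆A y (shrink w v)) f p

  FPSet⇒prunedFPTree : Associative _≡_ _∙_ → ∀ A → IsFPSet _∙_ A →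
    Σ (Pred (List S) 0ℓ) λ T → IsFPTree _∙_ T × IsPruned _∙_ T × TreeIn _∙_ A T
  FPSet⇒prunedFPTree assoc A (s , FP⊆A) =
    Path s , Path-isFPTree s , Path-pruned head∈FPSeq s , Path-treeIn s FP⊆A
    where
    open PathTree (FPSeq _∙_) (λ t _ (k , _) → t ∘ (k +_))
    open FPClosed (λ {t} (k , _) → FPSeq-drop t k) (λ {t} (k , x∈) → FPSeq-∙ assoc t k x∈)

    head∈FPSeq : ∀ t → ∃ (FPSeq _∙_ t)
    head∈FPSeq t = t 0 , 1 , FPList-singleton (t 0)

  module _ {T : Pred (List S) 0ℓ} where

    IsTree⇒root : IsTree _∙_ T → T []
    IsTree⇒root isTree =
      let (f , f∈T) = IsTree.nonempty isTree in IsTree.downClosed isTree f f∈T 0 z≤n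

    pruned⇒branch : IsTree _∙_ T → IsPruned _∙_ T →
                    Σ (ℕ → S) λ s → ∀ n → T (applyUpTo s n)
    pruned⇒branch isTree pruned = s , λ n → subst T (node≡ n) (proj₂ (node n))
      where
      node : ℕ → Σ (List S) T
      node zero    = [] , IsTree⇒root isTree
      node (suc n) = let (f , f∈T) = node n ; (x , fx∈T) = pruned f f∈T in f ++ x ∷ [] , fx∈T

      s : ℕ → S
      s n = let (f , f∈T) = node n in proj₁ (pruned f f∈T)

      node≡ : ∀ n → proj₁ (node n) ≡ applyUpTo s n
      node≡ zero    = refl
      node≡ (suc n) = trans (cong (_++ s n ∷ []) (node≡ n)) (applyUpTo-∷ʳ s n)

    branch⇒FPSeq⊆B[] : IsFPTree _∙_ T → ∀ {s} → (∀ n → T (applyUpTo s n)) →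
                       ∀ {y} → FPSeq _∙_ s y → B _∙_ T [] y
    branch⇒FPSeq⊆B[] (_ , fpTree) {s} branch {y} (n , y∈) =
      go n (subst (λ l → FPList _∙_ l y) (map-upTo s n) y∈)
      where
      go : ∀ n → FPList _∙_ (applyUpTo s n) y → B _∙_ T [] y
      go zero    y∈ = ⊥-elim (FPList-[] y∈)
      go (suc n) y∈ = Equivalence.from (fpTree [] (branch 0) y)
                        (s 0 , applyUpTo (s ∘ suc) n , branch (suc n) , y∈)

  prunedFPTree⇒FPSet : ∀ A →
    (Σ (Pred (List S) 0ℓ) λ T → IsFPTree _∙_ T × IsPruned _∙_ T × TreeIn _∙_ A T) →
    IsFPSet _∙_ A
  prunedFPTree⇒FPSet A (T , isFPTree , pruned , T⊆A) =
    let (s , branch) = pruned⇒branch (proj₁ isFPTree) pruned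
    in s , λ y y∈ → All.head (T⊆A (y ∷ []) (branch⇒FPSeq⊆B[] isFPTree branch y∈))

  _⁻¹·_ : S → Pred S 0ℓ → Pred S 0ℓ
  (x ⁻¹· C) y = C (x ∙ y)

  module _ (U : Ultrafilter _∙_) where

    _⋆ : Pred S 0ℓ → Pred S 0ℓ
    (C ⋆) x = C x × _∈U U (x ⁻¹· C)

    ⋆-∈U : IsIdempotent _∙_ U → ∀ {C} → _∈U U C → _∈U U (C ⋆)
    ⋆-∈U idem C∈U = inter U C∈U (Equivalence.to (idem _) C∈U)

    ∩⁻¹·-∈U : ∀ {C x} → (C ⋆) x → _∈U U C → _∈U U (C ∩ x ⁻¹· C)
    ∩⁻¹·-∈U (_ , x⁻¹C∈U) C∈U = inter U C∈U x⁻¹C∈U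

    ⋆-shrink : ∀ {C x y} → ((C ∩ x ⁻¹· C) ⋆) y → (C ⋆) y
    ⋆-shrink ((Cy , _) , yu∈U) = Cy , upward U (λ _ → proj₁) yu∈U

    ⋆-absorb : Associative _≡_ _∙_ → ∀ {C x z} → ((C ∩ x ⁻¹· C) ⋆) z → (C ⋆) (x ∙ z)
    ⋆-absorb assoc {C} {x} {z} ((_ , Cxz) , zu∈U) =
      Cxz , upward U (λ u → subst C (sym (assoc x z u)) ∘ proj₂) zu∈U

    idempotent⇒FPTree : Associative _≡_ _∙_ → IsIdempotent _∙_ U → ∀ {A} → _∈U U A →
      Σ (Pred (List S) 0ℓ) λ T →
        IsFPTree _∙_ T × TreeIn _∙_ A T × (∀ f → T f → _∈U U (B _∙_ T f))
    idempotent⇒FPTree assoc idem {A} A∈U =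
      Path A , Path-isFPTree A , Path-treeIn A (λ _ → proj₁) , B∈U
      where
      open PathTree _⋆ (λ C x _ → C ∩ x ⁻¹· C)
      open FPClosed (λ {C} {x} _ → ⋆-shrink {C} {x}) (λ {C} {x} _ → ⋆-absorb assoc {C} {x})

      B∈U : ∀ f → Path A f → _∈U U (B _∙_ (Path A) f)
      B∈U f p = upward U (λ _ → Path-∷ʳ A f p)
        (⋆-∈U idem (after-preserves (_∈U U) (λ _ _ → ∩⁻¹·-∈U) A f p A∈U))

theorem4p1p3 : (S : Set) (_∙_ : S → S → S) → IsSemigroup _≡_ _∙_ →
    (A : Pred S 0ℓ) →
    (IsFPSet _∙_ A ⇔ (Σ (Pred (List S) 0ℓ) λ T →
        IsFPTree _∙_ T × IsPruned _∙_ T × TreeIn _∙_ A T))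
    × (∀ (U : Ultrafilter _∙_) → IsIdempotent _∙_ U → _∈U U A →
        Σ (Pred (List S) 0ℓ) λ T →
          IsFPTree _∙_ T × TreeIn _∙_ A T ×
          (∀ f → T f → _∈U U (B _∙_ T f)))
theorem4p1p3 S _∙_ isSemigroup A =
  mk⇔ (FPSet⇒prunedFPTree _∙_ assoc A) (prunedFPTree⇒FPSet _∙_ A) ,
  λ U idem → idempotent⇒FPTree _∙_ U assoc idem
  where open IsSemigroup isSemigroup using (assoc)
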